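{- Let $h$ and $k$ be integers with $3\le h\le k-1$. Let $A=\{a_1,a_2,\ldots,a_k\}$ be a set of $k$ positive integers with $a_1<a_2<\cdots<a_k$, and let $A_{h+1}=\{a_1,\ldots,a_{h+1}\}$. If $\left|h^{\wedge}_{\pm}A_{h+1}\right|\ge (h+1)^2+t$ for some integer $t\ge 0$, then $$\left|h^{\wedge}_{\pm}A\right|\ge 2hk-h^2+1+t.$$
   Context: For a positive integer $h$ and a finite set of integers $A=\{a_1,\ldots,a_k\}$ (distinct elements), the restricted $h$-fold signed sumset is $h^{\wedge}_{\pm}A=\left\{\sum_{i=1}^k\lambda_i a_i:\lambda_i\in\{ -1,0,1\},\ \sum_{i=1}^k|\lambda_i|=h\right\}$. -}

module Defs where

open import Data.Nat using (ℕ; zero; suc; _+_; _<_)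
open import Data.Nat.Properties using () renaming (_≟_ to _≟ℕ_)
open import Data.Integer as ℤ using (ℤ; +_)
open import Data.Integer.Properties using () renaming (_≟_ to _≟ℤ_)
open import Data.List using (List; []; _∷_; map; concatMap; filterᵇ; length; deduplicate)
open import Data.Fin using (Fin)
open import Data.List using (tabulate)
open import Data.Product using (_×_; _,_; proj₁; proj₂)
open import Relation.Nullary.Decidable using (⌊_⌋)

data Sign : Set where
  neg zer pos : Sign

∣_∣ₛ : Sign → ℕ
∣ neg ∣ₛ = 1
∣ zer ∣ₛ = 0
∣ pos ∣ₛ = 1

act : Sign → ℤ → ℤ
act neg a = ℤ.- a
act zer a = + 0
act pos a = a

-- For a list of elements a_1,…,a_k, all choices (λ_1,…,λ_k) ∈ {-1,0,1}^k,
-- each recorded as (Σ |λ_i| , Σ λ_i a_i).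
signedSums : List ℤ → List (ℕ × ℤ)
signedSums [] = (0 , + 0) ∷ []
signedSums (a ∷ as) =
  concatMap (λ s → map (λ p → (∣ s ∣ₛ + proj₁ p , act s a ℤ.+ proj₂ p)) (signedSums as))
            (neg ∷ zer ∷ pos ∷ [])

-- The restricted h-fold signed sumset h^∧_± A, as a duplicate-free list
-- of integers, for A given by the list of its (distinct) elements.
restrictedSignedSumset : ℕ → List ℤ → List ℤ
restrictedSignedSumset h as =
  deduplicate _≟ℤ_ (map proj₂ (filterᵇ (λ p → ⌊ proj₁ p ≟ℕ h ⌋) (signedSums as)))

card-h∧± : ℕ → List ℤ → ℕ
card-h∧± h as = length (restrictedSignedSumset h as)

elems : {k : ℕ} → (Fin k → ℕ) → List ℤ
elems {k} a = tabulate (λ i → + (a i))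

-- If S is the sum of the h largest entries of a list ys of naturals, every signed h-sum of ys
-- lies in [-S, S]. For b larger than every entry of ys and y among those h largest entries,
-- b + (S - y) is a signed h-sum of b ∷ ys exceeding S; these h values are distinct, so together
-- with their negatives they are 2h new elements of the sumset. Adding the k - h - 1 elements of
-- A outside A_{h+1} one at a time, in increasing order, gives
-- |h^∧_± A| ≥ (h + 1)² + t + 2h(k - h - 1) = 2hk - h² + 1 + t.
module Submission where

open import Defs
open import Data.Nat using (ℕ; zero; suc; _+_; _*_; _∸_; _≤_; _<_; _>_; _^_; z≤n; s≤s)
open import Data.Nat.Properties
open import Data.Nat.ListAction using (sum)
import Algebra.Properties.CommutativeSemigroup as CommutativeSemigroupProperties
open import Data.Nat.Tactic.RingSolver using (solve-∀)
open import Data.Integer as ℤ using (ℤ)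
import Data.Integer.Properties as ℤ
open import Data.Integer.Properties using () renaming (_≟_ to _≟ℤ_)
open import Data.List
  using (List; []; _∷_; _++_; map; length; take; drop; reverse; tabulate)
open import Data.List.Properties
  using (length-map; length-++; length-take; length-drop; length-reverse; length-tabulate;
         take-map; map-tabulate; length-++-≤ʳ; take++drop≡id; reverse-++; unfold-reverse)
open import Data.List.Membership.Propositional using (_∈_; lose; find)
open import Data.List.Membership.Propositional.Properties
  using (∈-map⁺; ∈-map⁻; ∈-++⁺ˡ; ∈-++⁺ʳ; ∈-++⁻; ∈-∃++; ∈-concatMap⁺; ∈-concatMap⁻;
         ∈-filter⁺; ∈-filter⁻)
open import Data.List.Relation.Unary.Any using (here; there)
import Data.List.Relation.Unary.Any.Properties as Any
open import Data.List.Relation.Unary.All as All using (All; []; _∷_)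
open import Data.List.Relation.Unary.AllPairs as AllPairs using (AllPairs; []; _∷_)
import Data.List.Relation.Unary.AllPairs.Properties as AllPairs
open import Data.List.Relation.Unary.Unique.Propositional using (Unique)
import Data.List.Relation.Unary.Unique.Propositional.Properties as Unique
open import Data.List.Relation.Unary.Unique.DecPropositional.Properties _≟ℤ_ using (deduplicate-!)
open import Data.List.Relation.Binary.Subset.Propositional using (_⊆_)
open import Data.List.Relation.Binary.Disjoint.Propositional using (Disjoint)
open import Data.List.Relation.Binary.Permutation.Propositional
  using (_↭_; refl; prep; swap; trans; ↭-sym)
open import Data.List.Relation.Binary.Permutation.Propositional.Properties
  using (All-resp-↭; ↭-reverse)
  renaming (map⁺ to ↭-map⁺)
open import Data.Fin using (Fin; toℕ)
open import Data.Product using (_×_; _,_; proj₁; proj₂; ∃-syntax)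
open import Data.Sum using (_⊎_; inj₁; inj₂)
open import Function using (flip; case_of_)
open import Relation.Binary.PropositionalEquality
  using (_≡_; _≢_; refl; sym; cong; cong₂; subst; subst₂; module ≡-Reasoning)
  renaming (trans to ≡-trans)
open import Relation.Nullary using (contradiction)
open import Relation.Nullary.Decidable using (fromWitness; toWitness)

private
  module ℕ-CS = CommutativeSemigroupProperties +-commutativeSemigroup
  module ℤ-CS = CommutativeSemigroupProperties ℤ.+-commutativeSemigroup

  variable
    b y : ℕ
    n h : ℕ
    x : ℤ
    as : List ℤ
    ys : List ℕ

Unique-⊆⇒length≤ : {A : Set} {xs zs : List A} → Unique xs → xs ⊆ zs → length xs ≤ length zs
Unique-⊆⇒length≤ {xs = []} _ _ = z≤n
Unique-⊆⇒length≤ {xs = v ∷ xs} (v∉xs ∷ uniq) xs⊆zs with ∈-∃++ (xs⊆zs (here refl))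
... | us , ws , refl = begin
  suc (length xs)          ≤⟨ s≤s (Unique-⊆⇒length≤ uniq xs⊆us++ws) ⟩
  suc (length (us ++ ws))  ≡⟨ cong suc (length-++ us) ⟩
  suc (length us + length ws) ≡⟨ sym (+-suc (length us) (length ws)) ⟩
  length us + length (v ∷ ws) ≡⟨ sym (length-++ us) ⟩
  length (us ++ v ∷ ws)    ∎
  where
  open ≤-Reasoning
  xs⊆us++ws : xs ⊆ us ++ ws
  xs⊆us++ws {u} u∈xs with ∈-++⁻ us (xs⊆zs (there u∈xs))
  ... | inj₁ u∈us = ∈-++⁺ˡ u∈us
  ... | inj₂ (here refl) = contradiction refl (All.lookup v∉xs u∈xs)
  ... | inj₂ (there u∈ws) = ∈-++⁺ʳ us u∈ws

data SignedSum : List ℤ → ℕ → ℤ → Set where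
  []  : SignedSum [] 0 (ℤ.+ 0)
  _∷_ : ∀ {a as n x} (s : Sign) → SignedSum as n x →
        SignedSum (a ∷ as) (∣ s ∣ₛ + n) (act s a ℤ.+ x)

private
  signs : List Sign
  signs = neg ∷ zer ∷ pos ∷ []

  ∈-signs : (s : Sign) → s ∈ signs
  ∈-signs neg = here refl
  ∈-signs zer = there (here refl)
  ∈-signs pos = there (there (here refl))

  extend : ℤ → Sign → ℕ × ℤ → ℕ × ℤ
  extend a s p = ∣ s ∣ₛ + proj₁ p , act s a ℤ.+ proj₂ p

  extensions : ℤ → List ℤ → Sign → List (ℕ × ℤ)
  extensions a as s = map (extend a s) (signedSums as)

∈-signedSums⁺ : SignedSum as n x → (n , x) ∈ signedSums as
∈-signedSums⁺ [] = here refl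
∈-signedSums⁺ {a ∷ as} (s ∷ r) =
  ∈-concatMap⁺ (extensions a as) (lose (∈-signs s) (∈-map⁺ (extend a s) (∈-signedSums⁺ r)))

∈-signedSums⁻ : (n , x) ∈ signedSums as → SignedSum as n x
∈-signedSums⁻ {as = []} (here refl) = []
∈-signedSums⁻ {as = a ∷ as} nx∈ with find (∈-concatMap⁻ (extensions a as) {xs = signs} nx∈)
... | s , _ , nx∈′ with ∈-map⁻ (extend a s) nx∈′
...   | _ , my∈ , refl = s ∷ ∈-signedSums⁻ my∈

∈-restrictedSignedSumset⁺ : SignedSum as h x → x ∈ restrictedSignedSumset h as
∈-restrictedSignedSumset⁺ r =
  Any.deduplicate⁺ _≟ℤ_ (λ y≡x y≡z → ≡-trans y≡z (sym y≡x))
    (∈-map⁺ proj₂ (∈-filter⁺ _ (∈-signedSums⁺ r) (fromWitness refl)))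

∈-restrictedSignedSumset⁻ : x ∈ restrictedSignedSumset h as → SignedSum as h x
∈-restrictedSignedSumset⁻ x∈ with ∈-map⁻ proj₂ (Any.deduplicate⁻ _≟ℤ_ x∈)
... | _ , p∈ , refl with ∈-filter⁻ _ p∈
...   | p∈′ , n≡h = subst (λ m → SignedSum _ m _) (toWitness n≡h) (∈-signedSums⁻ p∈′)

SignedSum-swap : ∀ {a b as n x} → SignedSum (a ∷ b ∷ as) n x → SignedSum (b ∷ a ∷ as) n x
SignedSum-swap {a} {b} (s ∷ (s′ ∷ r)) =
  subst₂ (SignedSum _) (ℕ-CS.x∙yz≈y∙xz ∣ s′ ∣ₛ ∣ s ∣ₛ _) (ℤ-CS.x∙yz≈y∙xz (act s′ b) (act s a) _)
    (s′ ∷ (s ∷ r))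

SignedSum-resp-↭ : ∀ {as bs} → as ↭ bs → SignedSum as n x → SignedSum bs n x
SignedSum-resp-↭ refl r = r
SignedSum-resp-↭ (prep _ p) (s ∷ r) = s ∷ SignedSum-resp-↭ p r
SignedSum-resp-↭ (swap _ _ p) (s ∷ (s′ ∷ r)) = SignedSum-swap (s ∷ (s′ ∷ SignedSum-resp-↭ p r))
SignedSum-resp-↭ (trans p q) r = SignedSum-resp-↭ q (SignedSum-resp-↭ p r)

private
  opposite : Sign → Sign
  opposite neg = pos
  opposite zer = zer
  opposite pos = neg

  ∣opposite∣ : ∀ s → ∣ opposite s ∣ₛ ≡ ∣ s ∣ₛ
  ∣opposite∣ neg = refl
  ∣opposite∣ zer = refl
  ∣opposite∣ pos = refl

  act-opposite : ∀ s a → act (opposite s) a ≡ ℤ.- act s a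
  act-opposite neg a = sym (ℤ.neg-involutive a)
  act-opposite zer a = refl
  act-opposite pos a = refl

SignedSum-neg : SignedSum as n x → SignedSum as n (ℤ.- x)
SignedSum-neg [] = []
SignedSum-neg {a ∷ _} (s ∷ r) =
  subst₂ (SignedSum _) (cong (_+ _) (∣opposite∣ s))
    (≡-trans (cong (ℤ._+ _) (act-opposite s a)) (sym (ℤ.neg-distrib-+ (act s a) _)))
    (opposite s ∷ SignedSum-neg r)

card-h∧±-mono : ∀ {as bs} → (∀ {x} → SignedSum as h x → SignedSum bs h x) →
                card-h∧± h as ≤ card-h∧± h bs
card-h∧±-mono f =
  Unique-⊆⇒length≤ (deduplicate-! _) (λ x∈ → ∈-restrictedSignedSumset⁺ (f (∈-restrictedSignedSumset⁻ x∈)))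

card-h∧±-resp-↭ : ∀ {as bs} → as ↭ bs → card-h∧± h as ≡ card-h∧± h bs
card-h∧±-resp-↭ p =
  ≤-antisym (card-h∧±-mono (SignedSum-resp-↭ p)) (card-h∧±-mono (SignedSum-resp-↭ (↭-sym p)))

Descending : List ℕ → Set
Descending = AllPairs _>_

AllPairs-reverse⁺ : ∀ {A : Set} {R : A → A → Set} {xs} → AllPairs R xs → AllPairs (flip R) (reverse xs)
AllPairs-reverse⁺ [] = []
AllPairs-reverse⁺ {xs = v ∷ xs} (Rv ∷ Rxs) =
  subst (AllPairs _) (sym (unfold-reverse v xs))
    (AllPairs.++⁺ (AllPairs-reverse⁺ Rxs) ([] ∷ [])
      (All-resp-↭ (↭-sym (↭-reverse xs)) (All.map (_∷ []) Rv)))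

sum-take-≤ : ∀ n → Descending (y ∷ ys) → sum (take n ys) ≤ sum (take n (y ∷ ys))
sum-take-≤ zero _ = z≤n
sum-take-≤ {ys = []} (suc n) _ = z≤n
sum-take-≤ {ys = z ∷ zs} (suc n) ((z<y ∷ _) ∷ desc) = +-mono-≤ (<⇒≤ z<y) (sum-take-≤ n desc)

SignedSum-zeros : ∀ as → SignedSum as 0 (ℤ.+ 0)
SignedSum-zeros [] = []
SignedSum-zeros (_ ∷ as) = zer ∷ SignedSum-zeros as

SignedSum-sum-take : n ≤ length ys → SignedSum (map ℤ.+_ ys) n (ℤ.+ sum (take n ys))
SignedSum-sum-take {zero} {ys} _ = SignedSum-zeros (map ℤ.+_ ys)
SignedSum-sum-take {suc n} {y ∷ ys} (s≤s n≤) = pos ∷ SignedSum-sum-take n≤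

SignedSum-bound : Descending ys → SignedSum (map ℤ.+_ ys) n x → ℤ.∣ x ∣ ≤ sum (take n ys)
SignedSum-bound {[]} _ [] = z≤n
SignedSum-bound {y ∷ ys} desc@(_ ∷ desc′) (_∷_ {n = m} {x = x} zer r) = begin
  ℤ.∣ ℤ.+ 0 ℤ.+ x ∣       ≡⟨ cong ℤ.∣_∣ (ℤ.+-identityˡ x) ⟩
  ℤ.∣ x ∣               ≤⟨ SignedSum-bound desc′ r ⟩
  sum (take m ys)       ≤⟨ sum-take-≤ m desc ⟩
  sum (take m (y ∷ ys)) ∎
  where open ≤-Reasoning
SignedSum-bound {y ∷ ys} (_ ∷ desc′) (_∷_ {x = x} pos r) =
  ≤-trans (ℤ.∣i+j∣≤∣i∣+∣j∣ (ℤ.+ y) x) (+-monoʳ-≤ y (SignedSum-bound desc′ r))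
SignedSum-bound {y ∷ ys} (_ ∷ desc′) (_∷_ {x = x} neg r) =
  ≤-trans (ℤ.∣i+j∣≤∣i∣+∣j∣ (ℤ.- ℤ.+ y) x)
    (+-mono-≤ (≤-reflexive (ℤ.∣-i∣≡∣i∣ (ℤ.+ y))) (SignedSum-bound desc′ r))

leaveOneOutSums : ℕ → List ℕ → List ℕ
leaveOneOutSums zero ys = []
leaveOneOutSums (suc n) [] = []
leaveOneOutSums (suc n) (y ∷ ys) = sum (take n ys) ∷ map (y +_) (leaveOneOutSums n ys)

length-leaveOneOutSums : n ≤ length ys → length (leaveOneOutSums n ys) ≡ n
length-leaveOneOutSums {zero} _ = refl
length-leaveOneOutSums {suc n} {y ∷ ys} (s≤s n≤) =
  cong suc (≡-trans (length-map (y +_) (leaveOneOutSums n ys)) (length-leaveOneOutSums n≤))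

leaveOneOutSums-complement : ∀ {w} → w ∈ leaveOneOutSums n ys →
                             ∃[ z ] z ∈ ys × w + z ≡ sum (take n ys)
leaveOneOutSums-complement {suc n} {y ∷ ys} (here refl) = y , here refl , +-comm (sum (take n ys)) y
leaveOneOutSums-complement {suc n} {y ∷ ys} (there w∈) with ∈-map⁻ (y +_) w∈
... | w , w∈′ , refl with leaveOneOutSums-complement w∈′
...   | z , z∈ , w+z≡ = z , there z∈ , ≡-trans (+-assoc y w z) (cong (y +_) w+z≡)

leaveOneOutSums-< : ∀ {w} → All (_< b) ys → w ∈ leaveOneOutSums n ys → sum (take n ys) < b + w
leaveOneOutSums-< {b} {ys} {n} {w} ys<b w∈ with leaveOneOutSums-complement w∈
... | z , z∈ , w+z≡ = begin-strict
  sum (take n ys) ≡⟨ sym w+z≡ ⟩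
  w + z           <⟨ +-monoʳ-< w (All.lookup ys<b z∈) ⟩
  w + b           ≡⟨ +-comm w b ⟩
  b + w           ∎
  where open ≤-Reasoning

leaveOneOutSums-unique : Descending ys → Unique (leaveOneOutSums n ys)
leaveOneOutSums-unique {n = zero} _ = []
leaveOneOutSums-unique {[]} {suc n} _ = []
leaveOneOutSums-unique {y ∷ ys} {suc n} (ys<y ∷ desc) =
  All.tabulate first-fresh ∷ Unique.map⁺ (+-cancelˡ-≡ y _ _) (leaveOneOutSums-unique desc)
  where
  first-fresh : ∀ {v} → v ∈ map (y +_) (leaveOneOutSums n ys) → sum (take n ys) ≢ v
  first-fresh v∈ with ∈-map⁻ (y +_) v∈
  ... | _ , w∈ , refl = <⇒≢ (leaveOneOutSums-< ys<y w∈)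

leaveOneOutSums-signedSum : ∀ {w} → suc n ≤ length ys → w ∈ leaveOneOutSums (suc n) ys →
                            SignedSum (map ℤ.+_ ys) n (ℤ.+ w)
leaveOneOutSums-signedSum {n} {y ∷ ys} (s≤s n≤) (here refl) = zer ∷ SignedSum-sum-take n≤
leaveOneOutSums-signedSum {suc n} {y ∷ ys} (s≤s n≤) (there w∈) with ∈-map⁻ (y +_) w∈
... | _ , w∈′ , refl = pos ∷ leaveOneOutSums-signedSum n≤ w∈′

cons-leaveOneOutSums-signedSum : ∀ {w} → h ≤ length ys → w ∈ leaveOneOutSums h ys →
                                 SignedSum (map ℤ.+_ (b ∷ ys)) h (ℤ.+ (b + w))
cons-leaveOneOutSums-signedSum {suc h} h≤ w∈ = pos ∷ leaveOneOutSums-signedSum h≤ w∈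

signed : List ℕ → List ℤ
signed ws = map ℤ.+_ ws ++ map (λ w → ℤ.- ℤ.+ w) ws

∈-signed⁻ : ∀ {ws} → x ∈ signed ws → ∃[ w ] w ∈ ws × (x ≡ ℤ.+ w ⊎ x ≡ ℤ.- ℤ.+ w)
∈-signed⁻ {ws = ws} x∈ with ∈-++⁻ (map ℤ.+_ ws) x∈
... | inj₁ x∈⁺ with ∈-map⁻ ℤ.+_ x∈⁺
...   | w , w∈ , x≡ = w , w∈ , inj₁ x≡
∈-signed⁻ {ws = ws} x∈ | inj₂ x∈⁻ with ∈-map⁻ (λ w → ℤ.- ℤ.+ w) x∈⁻
...   | w , w∈ , x≡ = w , w∈ , inj₂ x≡

∣∣-∈-signed : ∀ {ws} → x ∈ signed ws → ℤ.∣ x ∣ ∈ ws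
∣∣-∈-signed x∈ with ∈-signed⁻ x∈
... | _ , w∈ , inj₁ refl = w∈
... | w , w∈ , inj₂ refl = subst (_∈ _) (sym (ℤ.∣-i∣≡∣i∣ (ℤ.+ w))) w∈

signed-⊆ : ∀ {ws} → (∀ {w} → w ∈ ws → SignedSum as n (ℤ.+ w)) →
           x ∈ signed ws → SignedSum as n x
signed-⊆ ws⊆ x∈ with ∈-signed⁻ x∈
... | _ , w∈ , inj₁ refl = ws⊆ w∈
... | _ , w∈ , inj₂ refl = SignedSum-neg (ws⊆ w∈)

length-signed : ∀ ws → length (signed ws) ≡ length ws + length ws
length-signed ws = ≡-trans (length-++ (map ℤ.+_ ws))
  (cong₂ _+_ (length-map ℤ.+_ ws) (length-map (λ w → ℤ.- ℤ.+ w) ws))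

signed-unique : ∀ {ws} → All (0 <_) ws → Unique ws → Unique (signed ws)
signed-unique {ws} ws>0 uniq =
  Unique.++⁺ (Unique.map⁺ ℤ.+-injective uniq)
    (Unique.map⁺ (λ eq → ℤ.+-injective (ℤ.neg-injective eq)) uniq) signs-differ
  where
  signs-differ : Disjoint (map ℤ.+_ ws) (map (λ w → ℤ.- ℤ.+ w) ws)
  signs-differ (x∈⁺ , x∈⁻) with ∈-map⁻ ℤ.+_ x∈⁺ | ∈-map⁻ (λ w → ℤ.- ℤ.+ w) x∈⁻
  ... | _ , _ , refl | _ , w∈ , eq with All.lookup ws>0 w∈
  ...   | s≤s _ with () ← eq

card-h∧±-cons : Descending (b ∷ ys) → h ≤ length ys →
                h + h + card-h∧± h (map ℤ.+_ ys) ≤ card-h∧± h (map ℤ.+_ (b ∷ ys))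
card-h∧±-cons {b} {ys} {h} (ys<b ∷ desc) h≤ = begin
  h + h + length old               ≡⟨ cong (_+ length old) (sym length-new) ⟩
  length new + length old          ≡⟨ sym (length-++ new) ⟩
  length (new ++ old)              ≤⟨ Unique-⊆⇒length≤ new++old-unique new++old-⊆ ⟩
  card-h∧± h (map ℤ.+_ (b ∷ ys))  ∎
  where
  open ≤-Reasoning
  S = sum (take h ys)
  W = map (b +_) (leaveOneOutSums h ys)
  new = signed W
  old = restrictedSignedSumset h (map ℤ.+_ ys)

  length-new : length new ≡ h + h
  length-new = ≡-trans (length-signed W)
    (cong (λ l → l + l) (≡-trans (length-map (b +_) (leaveOneOutSums h ys)) (length-leaveOneOutSums {h} {ys} h≤)))

  S<W : All (S <_) W
  S<W = All.tabulate λ w∈ → case ∈-map⁻ (b +_) w∈ of λ where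
    (_ , v∈ , refl) → leaveOneOutSums-< ys<b v∈

  W-signedSum : ∀ {w} → w ∈ W → SignedSum (map ℤ.+_ (b ∷ ys)) h (ℤ.+ w)
  W-signedSum w∈ = case ∈-map⁻ (b +_) w∈ of λ where
    (_ , v∈ , refl) → cons-leaveOneOutSums-signedSum h≤ v∈

  new++old-unique : Unique (new ++ old)
  new++old-unique =
    Unique.++⁺ (signed-unique (All.map (≤-<-trans z≤n) S<W)
                  (Unique.map⁺ (+-cancelˡ-≡ b _ _) (leaveOneOutSums-unique desc)))
               (deduplicate-! _)
               (λ (x∈new , x∈old) → <⇒≱ (All.lookup S<W (∣∣-∈-signed x∈new))
                                        (SignedSum-bound desc (∈-restrictedSignedSumset⁻ x∈old)))

  new++old-⊆ : new ++ old ⊆ restrictedSignedSumset h (map ℤ.+_ (b ∷ ys))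
  new++old-⊆ {x} x∈ with ∈-++⁻ new x∈
  ... | inj₁ x∈new = ∈-restrictedSignedSumset⁺ (signed-⊆ W-signedSum x∈new)
  ... | inj₂ x∈old = ∈-restrictedSignedSumset⁺
    (subst (SignedSum (map ℤ.+_ (b ∷ ys)) h) (ℤ.+-identityˡ x) (zer ∷ ∈-restrictedSignedSumset⁻ {as = map ℤ.+_ ys} x∈old))

card-h∧±-++ : ∀ zs → Descending (zs ++ ys) → h ≤ length ys →
              length zs * (h + h) + card-h∧± h (map ℤ.+_ ys) ≤ card-h∧± h (map ℤ.+_ (zs ++ ys))
card-h∧±-++ [] _ _ = ≤-refl
card-h∧±-++ {ys} {h} (z ∷ zs) desc@(_ ∷ desc′) h≤ = begin
  (h + h + length zs * (h + h)) + card-h∧± h (map ℤ.+_ ys)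
    ≡⟨ +-assoc (h + h) _ _ ⟩
  h + h + (length zs * (h + h) + card-h∧± h (map ℤ.+_ ys))
    ≤⟨ +-monoʳ-≤ (h + h) (card-h∧±-++ zs desc′ h≤) ⟩
  h + h + card-h∧± h (map ℤ.+_ (zs ++ ys))
    ≤⟨ card-h∧±-cons desc (≤-trans h≤ (length-++-≤ʳ ys {zs})) ⟩
  card-h∧± h (map ℤ.+_ (z ∷ zs ++ ys)) ∎
  where open ≤-Reasoning

card-h∧±-ascending : ∀ {h m} ns → AllPairs _<_ ns → h ≤ m → m ≤ length ns →
  (length ns ∸ m) * (h + h) + card-h∧± h (map ℤ.+_ (take m ns)) ≤ card-h∧± h (map ℤ.+_ ns)
card-h∧±-ascending {h} {m} ns ascending h≤m m≤len = begin
  (length ns ∸ m) * (h + h) + card-h∧± h (map ℤ.+_ ws)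
    ≡⟨ cong₂ (λ l c → l * (h + h) + c) length-zs (sym (card-reverse ws)) ⟩
  length (reverse zs) * (h + h) + card-h∧± h (map ℤ.+_ (reverse ws))
    ≤⟨ card-h∧±-++ (reverse zs) descending h≤length-ws ⟩
  card-h∧± h (map ℤ.+_ (reverse zs ++ reverse ws))
    ≡⟨ cong (λ l → card-h∧± h (map ℤ.+_ l)) reverse-split ⟩
  card-h∧± h (map ℤ.+_ (reverse ns))
    ≡⟨ card-reverse ns ⟩
  card-h∧± h (map ℤ.+_ ns) ∎
  where
  open ≤-Reasoning
  ws = take m ns
  zs = drop m ns

  card-reverse : ∀ xs → card-h∧± h (map ℤ.+_ (reverse xs)) ≡ card-h∧± h (map ℤ.+_ xs)
  card-reverse xs = card-h∧±-resp-↭ (↭-map⁺ ℤ.+_ (↭-reverse xs))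

  length-zs : length ns ∸ m ≡ length (reverse zs)
  length-zs = sym (≡-trans (length-reverse zs) (length-drop m ns))

  h≤length-ws : h ≤ length (reverse ws)
  h≤length-ws = subst (h ≤_)
    (sym (≡-trans (length-reverse ws) (≡-trans (length-take m ns) (m≤n⇒m⊓n≡m m≤len)))) h≤m

  reverse-split : reverse zs ++ reverse ws ≡ reverse ns
  reverse-split = ≡-trans (sym (reverse-++ ws zs)) (cong reverse (take++drop≡id m ns))

  descending : Descending (reverse zs ++ reverse ws)
  descending = subst Descending (sym reverse-split) (AllPairs-reverse⁺ ascending)

2hk-h²-identity : ∀ {h k} t → h + 1 ≤ k →
  2 * h * k + 1 + t ∸ h ^ 2 ≡ (k ∸ (h + 1)) * (h + h) + ((h + 1) ^ 2 + t)
2hk-h²-identity {h} {k} t h+1≤k = begin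
  2 * h * k + 1 + t ∸ h ^ 2
    ≡⟨ cong (λ k → 2 * h * k + 1 + t ∸ h ^ 2) (sym (m+[n∸m]≡n h+1≤k)) ⟩
  2 * h * (h + 1 + d) + 1 + t ∸ h ^ 2
    ≡⟨ cong (_∸ h ^ 2) (polynomial-identity h d t) ⟩
  h ^ 2 + (d * (h + h) + ((h + 1) ^ 2 + t)) ∸ h ^ 2
    ≡⟨ m+n∸m≡n (h ^ 2) _ ⟩
  d * (h + h) + ((h + 1) ^ 2 + t) ∎
  where
  open ≡-Reasoning
  d = k ∸ (h + 1)
  -- Squares are written as their unfolding x * (x * 1), since the solver does not read _^_.
  polynomial-identity : ∀ h d t →
    2 * h * (h + 1 + d) + 1 + t ≡ h * (h * 1) + (d * (h + h) + ((h + 1) * ((h + 1) * 1) + t))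
  polynomial-identity = solve-∀

lemma2p2 : (h k t : ℕ) → 3 ≤ h → h ≤ k ∸ 1 →
    (a : Fin k → ℕ) →
    (∀ i → 0 < a i) →
    (∀ i j → toℕ i < toℕ j → a i < a j) →
    (h + 1) ^ 2 + t ≤ card-h∧± h (take (h + 1) (elems a)) →
    2 * h * k + 1 + t ∸ h ^ 2 ≤ card-h∧± h (elems a)
lemma2p2 h k t 3≤h h≤k∸1 a _ a-increasing card-h∧±A′ = begin
  2 * h * k + 1 + t ∸ h ^ 2
    ≡⟨ 2hk-h²-identity t h+1≤k ⟩
  (k ∸ (h + 1)) * (h + h) + ((h + 1) ^ 2 + t)
    ≤⟨ +-monoʳ-≤ _ (subst (λ l → _ ≤ card-h∧± h l) elems-take card-h∧±A′) ⟩
  (k ∸ (h + 1)) * (h + h) + card-h∧± h (map ℤ.+_ (take (h + 1) ns))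
    ≡⟨ cong (λ l → (l ∸ (h + 1)) * (h + h) + card-h∧± h (map ℤ.+_ (take (h + 1) ns)))
         (sym (length-tabulate a)) ⟩
  (length ns ∸ (h + 1)) * (h + h) + card-h∧± h (map ℤ.+_ (take (h + 1) ns))
    ≤⟨ card-h∧±-ascending ns (AllPairs.tabulate⁺-< (a-increasing _ _)) (m≤m+n h 1)
         (subst (h + 1 ≤_) (sym (length-tabulate a)) h+1≤k) ⟩
  card-h∧± h (map ℤ.+_ ns)
    ≡⟨ cong (card-h∧± h) (map-tabulate a (ℤ.+_)) ⟩
  card-h∧± h (elems a) ∎
  where
  open ≤-Reasoning
  ns = tabulate a
  h+1≤k : h + 1 ≤ k
  h+1≤k = m≤o∸n⇒m+n≤o h (≤-trans (≤-trans (≤-trans (s≤s z≤n) 3≤h) h≤k∸1) (m∸n≤m k 1)) h≤k∸1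
  elems-take : take (h + 1) (elems a) ≡ map ℤ.+_ (take (h + 1) ns)
  elems-take = ≡-trans (cong (take (h + 1)) (sym (map-tabulate a (ℤ.+_)))) (take-map (h + 1) ns)
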